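{- (1) Let $\mathbf{S}=\vee[\mathbf{F}_0,\dots,\mathbf{F}_{n-1}]$ be a sequent. Suppose that for some $k<n$, either $\mathbf{F}_k$ is a disjunctive formula whose arity is nonempty, or $\mathbf{F}_k$ is a conjunctive formula. Then $\mathbf{S}$ is derivable. (2) Let $\mathbf{v}\doteq\mathbf{F}$ be a recursive equation and let $\mathbf{G}$ be its unique solution. Then the sequent $\vee[\mathbf{G}]$ is derivable.
   Context: Positions are finite sequences of natural numbers; $\langle\rangle$ is the empty one, $\star$ concatenation, $\langle i\rangle$ a length-one position. A tree labeled by $L$ is a partial function from positions to $L$ with domain containing $\langle\rangle$ and closed under prefixes; a leaf is a domain element with no proper extension in the domain. For a product label set, $T_L(p),T_R(p)$ denote the components of $T(p)$. Formulas are trees labeled by $\{\vee,\wedge\}\cup\{\mathbf{v}=(+,v)\}\cup\{\neg\mathbf{v}=(-,v)\}$ ($v\in\mathbb{N}$) with variable-labeled positions being leaves; they may be infinitely branching and ill-founded. A compound formula with root $\vee$ (resp. $\wedge$) is disjunctive (resp. conjunctive); its arity is $I=\{i:\langle i\rangle\in\mathrm{dom}(\mathbf{F})\}$, and it is written $\vee_I\mathbf{F}_{\langle i\rangle}$ (resp. $\wedge_I\mathbf{F}_{\langle i\rangle}$) where $\mathbf{F}_{\langle i\rangle}$ is the subtree at $\langle i\rangle$. $\vee[\mathbf{F}_0,\dots,\mathbf{F}_{n-1}]$ is the disjunctive formula with arity $\{0,\dots,n-1\}$ and immediate subformulas $\mathbf{F}_k$. Negation swaps $\mathbf{v}\leftrightarrow\neg\mathbf{v}$,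 $\vee\leftrightarrow\wedge$ everywhere. A sequent is a disjunctive formula of arity $\{0,\dots,n-1\}$ for some $n$; $\mathbf{S}\vee\mathbf{G}$ denotes $\vee[\mathbf{F}_0,\dots,\mathbf{F}_{n-1},\mathbf{G}]$. Rules: $(\mathbf{v},k,\ell)$, $(\vee,k,i_0)$, $(\wedge,k)$ with $k,\ell,i_0\in\mathbb{N}$. A derivation is a (possibly ill-founded) tree $T$ labeled by (sequents)$\times$(rules) such that for each $p$ in its domain, with $T_L(p)=\vee[\mathbf{F}_0,\dots,\mathbf{F}_{n-1}]$, one of: (ax) $T_R(p)=(\mathbf{v},k,\ell)$, $k,\ell<n$, $\mathbf{F}_k=\mathbf{v}$, $\mathbf{F}_\ell=\neg\mathbf{v}$, $p$ a leaf; ($\vee$) $T_R(p)=(\vee,k,i_0)$, $k<n$, $\mathbf{F}_k=\vee_I\mathbf{G}_{\langle i\rangle}$, $i_0\in I$, the only child of $p$ is $p\star\langle i_0\rangle$ and $T_L(p\star\langle i_0\rangle)=T_L(p)\vee\mathbf{G}_{\langle i_0\rangle}$; ($\wedge$) $T_R(p)=(\wedge,k)$, $k<n$, $\mathbf{F}_k=\wedge_I\mathbf{G}_{\langle i\rangle}$, the children of $p$ are exactly $p\star\langle i\rangle$, $i\in I$, with $T_L(p\star\langle i\rangle)=T_L(p)\vee\mathbf{G}_{\langle i\rangle}$. $\mathbf{S}$ is derivable if some derivation $\pi$ has $\pi_L(\langle\rangle)=\mathbf{S}$. Substitution $\mathbf{F}[\mathbf{G}/\mathbf{v}]$ ($\mathbf{v}$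 positive): replace each leaf $r$ of $\mathbf{F}$ labeled $\mathbf{v}$ by a copy of $\mathbf{G}$ and each leaf labeled $\neg\mathbf{v}$ by a copy of $\neg\mathbf{G}$ (domain $S\cup\{r\star q: r\in R, q\in\mathrm{dom}(\mathbf{G})\}$ where $R$ is the set of such leaves and $S=\mathrm{dom}(\mathbf{F})\setminus R$). A recursive equation $\mathbf{v}\doteq\mathbf{F}$ consists of a positive atom $\mathbf{v}$ and a compound formula $\mathbf{F}$ in which $\mathbf{v}$ or $\neg\mathbf{v}$ labels some position; its solution is the unique formula $\mathbf{G}$ with $\mathbf{G}=\mathbf{F}[\mathbf{G}/\mathbf{v}]$. -}

module Defs where

open import Data.Nat using (ℕ; zero; suc; _<_; _≡ᵇ_; _<ᵇ_)
open import Data.List using (List; []; _∷_; _++_; [_])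
open import Data.Maybe using (Maybe; just; nothing)
open import Data.Bool using (if_then_else_)
open import Data.Product using (Σ; ∃; _×_; _,_)
open import Data.Sum using (_⊎_)
open import Relation.Binary.PropositionalEquality using (_≡_; _≢_)
open import Relation.Nullary using (¬_)
open import Function.Bundles using (_⇔_)

Pos : Set
Pos = List ℕ

PTree : Set → Set
PTree L = Pos → Maybe L

InDom : {L : Set} → PTree L → Pos → Set
InDom t p = ∃ λ l → t p ≡ just l

IsTree : {L : Set} → PTree L → Set
IsTree t = InDom t [] × (∀ p q → InDom t (p ++ q) → InDom t p)

Leaf : {L : Set} → PTree L → Pos → Set
Leaf t p = InDom t p × (∀ q → q ≢ [] → ¬ InDom t (p ++ q))

data FLab : Set where
  disj conj : FLab
  pos neg   : ℕ → FLab     -- pos v = 𝐯 = (+,v),  neg v = ¬𝐯 = (-,v)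

Raw : Set
Raw = PTree FLab

IsVarLab : Maybe FLab → Set
IsVarLab l = ∃ λ v → (l ≡ just (pos v)) ⊎ (l ≡ just (neg v))

IsFormula : Raw → Set
IsFormula F = IsTree F × (∀ p → IsVarLab (F p) → Leaf F p)

_≈_ : Raw → Raw → Set
F ≈ G = ∀ p → F p ≡ G p

sub : Raw → ℕ → Raw
sub F i q = F (i ∷ q)

Disjunctive Conjunctive Compound : Raw → Set
Disjunctive F = F [] ≡ just disj
Conjunctive F = F [] ≡ just conj
Compound F = Disjunctive F ⊎ Conjunctive F

-- arity membership: i ∈ I iff ⟨i⟩ ∈ dom F
InArity : Raw → ℕ → Set
InArity F i = InDom F [ i ]

atom : FLab → Raw
atom l []      = just l
atom l (_ ∷ _) = nothing

negLab : FLab → FLab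
negLab disj    = conj
negLab conj    = disj
negLab (pos v) = neg v
negLab (neg v) = pos v

negF : Raw → Raw
negF G p = Data.Maybe.map negLab (G p)

-- S is a sequent ∨[F_0,…,F_{n-1}] (with F_k = sub S k)
IsSequent : Raw → ℕ → Set
IsSequent S n = IsFormula S × Disjunctive S × (∀ i → InArity S i ⇔ (i < n))

extend : ℕ → Raw → Raw → Raw
extend n S G []      = just disj
extend n S G (i ∷ q) =
  if i <ᵇ n then S (i ∷ q) else (if i ≡ᵇ n then G q else nothing)

single : Raw → Raw
single G []            = just disj
single G (zero ∷ q)    = G q
single G (suc _ ∷ _)   = nothing

data Rule : Set where
  ax  : ℕ → ℕ → ℕ → Rule   -- (𝐯 , k , ℓ)
  or  : ℕ → ℕ → Rule       -- (∨ , k , i₀)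
  and : ℕ → Rule           -- (∧ , k)

DTree : Set
DTree = PTree (Raw × Rule)

HasSeq : DTree → Pos → Raw → Set
HasSeq T p S = ∃ λ S' → ∃ λ r → (T p ≡ just (S' , r)) × (S' ≈ S)

RuleOK : DTree → Pos → Raw → ℕ → Rule → Set
RuleOK T p S n (ax v k ℓ) =
  (k < n) × (ℓ < n) × (sub S k ≈ atom (pos v)) × (sub S ℓ ≈ atom (neg v))
  × Leaf T p
RuleOK T p S n (or k i₀) =
  (k < n) × Disjunctive (sub S k) × InArity (sub S k) i₀
  × (∀ j → InDom T (p ++ [ j ]) ⇔ (j ≡ i₀))
  × HasSeq T (p ++ [ i₀ ]) (extend n S (sub (sub S k) i₀))
RuleOK T p S n (and k) =
  (k < n) × Conjunctive (sub S k)
  × (∀ j → InDom T (p ++ [ j ]) ⇔ InArity (sub S k) j)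
  × (∀ j → InArity (sub S k) j →
       HasSeq T (p ++ [ j ]) (extend n S (sub (sub S k) j)))

IsDerivation : DTree → Set
IsDerivation T =
  IsTree T ×
  (∀ p S r → T p ≡ just (S , r) → ∃ λ n → IsSequent S n × RuleOK T p S n r)

Derivable : Raw → Set
Derivable S = ∃ λ T → IsDerivation T × HasSeq T [] S

substF : Raw → Raw → ℕ → Raw
substF F G v p with F []
substF F G v p | just (pos w) = if w ≡ᵇ v then G p else F p
substF F G v p | just (neg w) = if w ≡ᵇ v then negF G p else F p
substF F G v [] | _ = F []
substF F G v (i ∷ q) | _ = substF (sub F i) G v q

IsRecEq : ℕ → Raw → Set
IsRecEq v F = IsFormula F × Compound F ×
  (∃ λ p → (F p ≡ just (pos v)) ⊎ (F p ≡ just (neg v)))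

IsSolution : ℕ → Raw → Raw → Set
IsSolution v F G = IsFormula G × (G ≈ substF F G v)

module Submission where

-- (1) Suppose F_k is disjunctive with some i₀ in its arity.  Applying
-- (∨,k,i₀) to S gives S ∨ (F_k)_{i₀}, which still has F_k at place k, so the
-- same rule applies again, forever: this is an ill-founded derivation.  If F_k
-- is conjunctive, (∧,k) is applied forever in the same way, branching over the
-- whole arity of F_k.  Both derivations are instances of one construction
-- (module Repeat): for a principal formula H, a rule r and a decidable set g of
-- admissible child indices, the node at ⟨j₁,…,jₘ⟩ (all jᵢ in g) is labelled
-- (S ∨ H_{j₁} ∨ … ∨ H_{jₘ} , r).  Its correctness rests on the facts that
-- extending a sequent yields a sequent and keeps earlier formulas in place.
--
-- (2) Since F is compound, the solution G has the root of F; and since 𝐯 or ¬𝐯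
-- occurs strictly below that root, F and hence G has an immediate
-- subformula.  Thus ∨[G] = ∨[] ∨ G meets the hypothesis of (1) with k = 0.

open import Defs
open import Data.Nat using (ℕ; _<_; suc; _≡ᵇ_; _<ᵇ_; z<s; s<s)
open import Data.Nat.Properties
  using (<⇒<ᵇ; <ᵇ⇒<; ≡⇒≡ᵇ; ≡ᵇ⇒≡; <-cmp; <-irrefl; <-asym; <-≤-trans; n<1+n; m<n⇒m<1+n)
open import Data.Product using (∃; _×_; _,_; proj₁)
open import Data.Sum using (_⊎_; inj₁; inj₂)
open import Data.Bool using (Bool; true; false; T; if_then_else_)
open import Data.Bool.Properties using (T-≡)
open import Data.Empty using (⊥-elim)
open import Data.List using ([]; _∷_; _++_; [_])
open import Data.List.Properties using (++-identityʳ)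
open import Data.Maybe using (Maybe; just; nothing; _>>=_; is-just)
import Data.Maybe as Maybe
open import Relation.Binary.PropositionalEquality
  using (_≡_; refl; sym; trans; cong; subst)
open import Relation.Nullary using (¬_)
open import Relation.Binary.Definitions using (tri<; tri≈; tri>)
open import Function.Bundles using (_⇔_; mk⇔; Equivalence)
import Function.Properties.Equivalence as ⇔

open Equivalence using (to; from)

IsJust : {A : Set} → Maybe A → Set
IsJust x = ∃ λ a → x ≡ just a

isJust-≡ : {A : Set} {x y : Maybe A} → x ≡ y → IsJust x → IsJust y
isJust-≡ e (a , e') = a , trans (sym e) e'

nothing-undefined : {A : Set} {x : Maybe A} → x ≡ nothing → ¬ IsJust x
nothing-undefined refl (_ , ())

is-just⇔IsJust : {A : Set} (x : Maybe A) → T (is-just x) ⇔ IsJust x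
is-just⇔IsJust (just a) = mk⇔ (λ _ → a , refl) (λ _ → _)
is-just⇔IsJust nothing  = mk⇔ (λ ()) (λ { (_ , ()) })

map-defined : {A B : Set} (f : A → B) (x : Maybe A) → IsJust (Maybe.map f x) ⇔ IsJust x
map-defined f (just a) = mk⇔ (λ _ → a , refl) (λ _ → f a , refl)
map-defined f nothing  = mk⇔ (λ { (_ , ()) }) (λ { (_ , ()) })

false-of-¬T : {b : Bool} → ¬ T b → b ≡ false
false-of-¬T {false} _ = refl
false-of-¬T {true}  f = ⊥-elim (f _)

var-≡ : {l l' : Maybe FLab} → l ≡ l' → IsVarLab l → IsVarLab l'
var-≡ refl x = x

disj-not-var : ¬ IsVarLab (just disj)
disj-not-var (_ , inj₁ ())
disj-not-var (_ , inj₂ ())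

conj-not-var : ¬ IsVarLab (just conj)
conj-not-var (_ , inj₁ ())
conj-not-var (_ , inj₂ ())

nothing-not-var : ¬ IsVarLab nothing
nothing-not-var (_ , inj₁ ())
nothing-not-var (_ , inj₂ ())

compound-not-var : {F : Raw} → Compound F → ¬ IsVarLab (F [])
compound-not-var (inj₁ e) x = disj-not-var (var-≡ e x)
compound-not-var (inj₂ e) x = conj-not-var (var-≡ e x)

leaf-transport : (t t' : Raw) (p p' : Pos) →
                 (∀ q → t (p ++ q) ≡ t' (p' ++ q)) → Leaf t p → Leaf t' p'
leaf-transport t t' p p' e (d , maximal) =
  isJust-≡ root-eq d , λ q q≢[] d' → maximal q q≢[] (isJust-≡ (sym (e q)) d')
  where
  root-eq : t p ≡ t' p'
  root-eq = trans (cong t (sym (++-identityʳ p)))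
                  (trans (e []) (cong t' (++-identityʳ p')))

sub-formula : {H : Raw} {j : ℕ} → IsFormula H → InArity H j → IsFormula (sub H j)
sub-formula ((_ , prefix) , leaves) d =
  (d , λ p q → prefix (_ ∷ p) q) , λ p → leaves (_ ∷ p)

member-formula : {S : Raw} {n k : ℕ} → IsSequent S n → k < n → IsFormula (sub S k)
member-formula (fS , _ , arity) k<n = sub-formula fS (from (arity _) k<n)

module _ (n : ℕ) (S G : Raw) where

  extend-below : {i : ℕ} (q : Pos) → i < n → extend n S G (i ∷ q) ≡ S (i ∷ q)
  extend-below q i<n rewrite to T-≡ (<⇒<ᵇ i<n) = refl

  extend-at : (q : Pos) → extend n S G (n ∷ q) ≡ G q
  extend-at q
    rewrite false-of-¬T {n <ᵇ n} (λ t → <-irrefl refl (<ᵇ⇒< n n t))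
          | to T-≡ (≡⇒≡ᵇ n n refl) = refl

  extend-above : {i : ℕ} (q : Pos) → n < i → extend n S G (i ∷ q) ≡ nothing
  extend-above {i} q n<i
    rewrite false-of-¬T {i <ᵇ n} (λ t → <-asym n<i (<ᵇ⇒< i n t))
          | false-of-¬T {i ≡ᵇ n} (λ t → <-irrefl (sym (≡ᵇ⇒≡ i n t)) n<i) = refl

extend-cong : {n : ℕ} (S : Raw) {G G' : Raw} → G ≈ G' → extend n S G ≈ extend n S G'
extend-cong S e []      = refl
extend-cong {n} S e (i ∷ q) =
  cong (λ x → if i <ᵇ n then S (i ∷ q) else (if i ≡ᵇ n then x else nothing)) (e q)

extend-formula : {n : ℕ} {S G : Raw} → IsSequent S n → IsFormula G → IsFormula (extend n S G)
extend-formula {n} {S} {G} (((_ , prefixS) , leavesS) , _) ((_ , prefixG) , leavesG) =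
  ((disj , refl) , prefix) , leaves
  where
  prefix : ∀ p q → InDom (extend n S G) (p ++ q) → InDom (extend n S G) p
  prefix []      q d = disj , refl
  prefix (i ∷ p) q d with <-cmp i n
  ... | tri< i<n _ _ = isJust-≡ (sym (extend-below n S G p i<n))
                         (prefixS (i ∷ p) q (isJust-≡ (extend-below n S G (p ++ q) i<n) d))
  ... | tri≈ _ refl _ = isJust-≡ (sym (extend-at n S G p))
                          (prefixG p q (isJust-≡ (extend-at n S G (p ++ q)) d))
  ... | tri> _ _ n<i = ⊥-elim (nothing-undefined (extend-above n S G (p ++ q) n<i) d)

  leaves : ∀ p → IsVarLab (extend n S G p) → Leaf (extend n S G) p
  leaves []      x = ⊥-elim (disj-not-var x)
  leaves (i ∷ p) x with <-cmp i n
  ... | tri< i<n _ _ =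
    leaf-transport S (extend n S G) (i ∷ p) (i ∷ p) (λ q → sym (extend-below n S G (p ++ q) i<n))
      (leavesS (i ∷ p) (var-≡ (extend-below n S G p i<n) x))
  ... | tri≈ _ refl _ =
    leaf-transport G (extend n S G) p (n ∷ p) (λ q → sym (extend-at n S G (p ++ q)))
      (leavesG p (var-≡ (extend-at n S G p) x))
  ... | tri> _ _ n<i = ⊥-elim (nothing-not-var (var-≡ (extend-above n S G p n<i) x))

extend-sequent : {n : ℕ} {S G : Raw} → IsSequent S n → IsFormula G →
                 IsSequent (extend n S G) (suc n)
extend-sequent {n} {S} {G} seqS@(_ , _ , arityS) fG@((rootG , _) , _) =
  extend-formula seqS fG , refl , arity
  where
  arity : ∀ i → InArity (extend n S G) i ⇔ (i < suc n)
  arity i with <-cmp i n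
  ... | tri< i<n _ _ = mk⇔ (λ _ → m<n⇒m<1+n i<n)
                           (λ _ → isJust-≡ (sym (extend-below n S G [] i<n)) (from (arityS i) i<n))
  ... | tri≈ _ refl _ = mk⇔ (λ _ → n<1+n i) (λ _ → isJust-≡ (sym (extend-at n S G [])) rootG)
  ... | tri> _ _ n<i = mk⇔ (λ d → ⊥-elim (nothing-undefined (extend-above n S G [] n<i) d))
                           (λ { (s<s i≤n) → ⊥-elim (<-irrefl refl (<-≤-trans n<i i≤n)) })

derivable-resp-≈ : {S S' : Raw} → S ≈ S' → Derivable S → Derivable S'
derivable-resp-≈ e (T , isD , S₀ , r , root , S₀≈S) =
  T , isD , S₀ , r , root , λ q → trans (S₀≈S q) (e q)

module Repeat (k : ℕ) (H : Raw) (fH : IsFormula H) (r : Rule)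
              (g : ℕ → Bool) (g-arity : ∀ j → T (g j) → InArity H j)
              (n₀ : ℕ) (S₀ : Raw) where

  node : ℕ → Raw → Pos → Maybe (ℕ × Raw)
  node n S []      = just (n , S)
  node n S (j ∷ p) = if g j then node (suc n) (extend n S (sub H j)) p else nothing

  label : ℕ × Raw → Raw × Rule
  label (_ , S) = S , r

  tree : DTree
  tree p = Maybe.map label (node n₀ S₀ p)

  child : ℕ → ℕ × Raw → Maybe (ℕ × Raw)
  child j (m , S) = if g j then just (suc m , extend m S (sub H j)) else nothing

  node-snoc : ∀ n S p j → node n S (p ++ [ j ]) ≡ (node n S p >>= child j)
  node-snoc n S []      j = refl
  node-snoc n S (i ∷ p) j with g i
  ... | true  = node-snoc (suc n) (extend n S (sub H i)) p j
  ... | false = refl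

  node-prefix : ∀ n S p q → IsJust (node n S (p ++ q)) → IsJust (node n S p)
  node-prefix n S []      q d = _ , refl
  node-prefix n S (i ∷ p) q d with g i
  ... | true  = node-prefix (suc n) (extend n S (sub H i)) p q d
  ... | false = ⊥-elim (nothing-undefined refl d)

  tree-isTree : IsTree tree
  tree-isTree =
    (_ , refl) ,
    λ p q d → from (map-defined label _) (node-prefix n₀ S₀ p q (to (map-defined label _) d))

  Carries : ℕ → Raw → Set
  Carries m S = IsSequent S m × k < m × (sub S k ≈ H)

  carries-child : ∀ {n S} j → Carries n S → InArity H j → Carries (suc n) (extend n S (sub H j))
  carries-child {n} {S} j (seqS , k<n , Sk≈H) a =
    extend-sequent seqS (sub-formula fH a) , m<n⇒m<1+n k<n ,
    λ q → trans (extend-below n S (sub H j) q k<n) (Sk≈H q)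

  node-carries : ∀ n S p m S' → Carries n S → node n S p ≡ just (m , S') → Carries m S'
  node-carries n S []      m S' c refl = c
  node-carries n S (j ∷ p) m S' c e with g j in gj
  ... | true  = node-carries (suc n) _ p m S' (carries-child j c (g-arity j (subst T (sym gj) _))) e
  ... | false with e
  ...   | ()

  tree-child : ∀ p m S j → node n₀ S₀ p ≡ just (m , S) →
               tree (p ++ [ j ]) ≡ (if g j then just (extend m S (sub H j) , r) else nothing)
  tree-child p m S j e rewrite node-snoc n₀ S₀ p j | e with g j
  ... | true  = refl
  ... | false = refl

  children : ∀ p m S j → node n₀ S₀ p ≡ just (m , S) → InDom tree (p ++ [ j ]) ⇔ T (g j)
  children p m S j e with g j | tree-child p m S j e
  ... | true  | c = mk⇔ (λ _ → _) (λ _ → isJust-≡ (sym c) (_ , refl))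
  ... | false | c = mk⇔ (nothing-undefined c) (λ ())

  child-sequent : ∀ p m S j → node n₀ S₀ p ≡ just (m , S) → T (g j) → Carries m S →
                  HasSeq tree (p ++ [ j ]) (extend m S (sub (sub S k) j))
  child-sequent p m S j e _ (_ , _ , Sk≈H) with g j | tree-child p m S j e
  ... | true | c = _ , r , c , extend-cong S (λ q → sym (Sk≈H (j ∷ q)))

  repeat-derivable : (∀ p m S → node n₀ S₀ p ≡ just (m , S) → Carries m S → RuleOK tree p S m r) →
                     Carries n₀ S₀ → Derivable S₀
  repeat-derivable ok c₀ = tree , (tree-isTree , correct) , S₀ , r , refl , (λ _ → refl)
    where
    correct : ∀ p S r' → tree p ≡ just (S , r') → ∃ λ n → IsSequent S n × RuleOK tree p S n r'
    correct p S r' e with node n₀ S₀ p in np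
    correct p S r' refl | just (m , .S) =
      m , proj₁ (node-carries n₀ S₀ p m S c₀ np) , ok p m S np (node-carries n₀ S₀ p m S c₀ np)

principal-derivable : (S : Raw) (n k : ℕ) → IsSequent S n → k < n →
                      ((Disjunctive (sub S k) × ∃ (λ i → InArity (sub S k) i))
                        ⊎ Conjunctive (sub S k)) →
                      Derivable S
principal-derivable S n k seqS k<n (inj₁ (disjSk , i₀ , i₀∈I)) =
  repeat-derivable ok (seqS , k<n , λ _ → refl)
  where
  open Repeat k (sub S k) (member-formula seqS k<n) (or k i₀) (λ j → j ≡ᵇ i₀)
              (λ j t → subst (InArity (sub S k)) (sym (≡ᵇ⇒≡ j i₀ t)) i₀∈I) n S
  ok : ∀ p m S' → node n S p ≡ just (m , S') → Carries m S' → RuleOK tree p S' m (or k i₀)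
  ok p m S' e c@(_ , k<m , S'k≈Sk) =
    k<m , trans (S'k≈Sk []) disjSk , isJust-≡ (sym (S'k≈Sk [ i₀ ])) i₀∈I ,
    (λ j → ⇔.trans (children p m S' j e) (mk⇔ (≡ᵇ⇒≡ j i₀) (≡⇒≡ᵇ j i₀))) ,
    child-sequent p m S' i₀ e (≡⇒≡ᵇ i₀ i₀ refl) c
principal-derivable S n k seqS k<n (inj₂ conjSk) =
  repeat-derivable ok (seqS , k<n , λ _ → refl)
  where
  open Repeat k (sub S k) (member-formula seqS k<n) (and k) (λ j → is-just (S (k ∷ [ j ])))
              (λ j → to (is-just⇔IsJust (S (k ∷ [ j ])))) n S
  ok : ∀ p m S' → node n S p ≡ just (m , S') → Carries m S' → RuleOK tree p S' m (and k)
  ok p m S' e c@(_ , k<m , S'k≈Sk) =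
    k<m , trans (S'k≈Sk []) conjSk ,
    (λ j → ⇔.trans (children p m S' j e)
             (⇔.trans (is-just⇔IsJust (S (k ∷ [ j ])))
                      (mk⇔ (isJust-≡ (sym (S'k≈Sk [ j ]))) (isJust-≡ (S'k≈Sk [ j ]))))) ,
    (λ j d → child-sequent p m S' j e
               (from (is-just⇔IsJust (S (k ∷ [ j ]))) (isJust-≡ (S'k≈Sk [ j ]) d)) c)

emptySeq : Raw
emptySeq []      = just disj
emptySeq (_ ∷ _) = nothing

emptySeq-isSequent : IsSequent emptySeq 0
emptySeq-isSequent = (((disj , refl) , prefix) , leaves) , refl , λ i → mk⇔ (λ { (_ , ()) }) (λ ())
  where
  prefix : ∀ p q → InDom emptySeq (p ++ q) → InDom emptySeq p
  prefix []      q d       = disj , refl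
  prefix (_ ∷ _) q (_ , ())
  leaves : ∀ p → IsVarLab (emptySeq p) → Leaf emptySeq p
  leaves []      x = ⊥-elim (disj-not-var x)
  leaves (_ ∷ _) x = ⊥-elim (nothing-not-var x)

extend-emptySeq : (G : Raw) → extend 0 emptySeq G ≈ single G
extend-emptySeq G []          = refl
extend-emptySeq G (0 ∷ q)     = refl
extend-emptySeq G (suc _ ∷ q) = refl

single-derivable : {G : Raw} → IsFormula G →
                   ((Disjunctive G × ∃ (λ i → InArity G i)) ⊎ Conjunctive G) →
                   Derivable (single G)
single-derivable {G} fG shape =
  derivable-resp-≈ (extend-emptySeq G)
    (principal-derivable (extend 0 emptySeq G) 1 0 (extend-sequent emptySeq-isSequent fG) z<s shape)

substF-root : (F G : Raw) (v : ℕ) → Compound F → substF F G v [] ≡ F []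
substF-root F G v (inj₁ e) rewrite e = e
substF-root F G v (inj₂ e) rewrite e = e

substF-sub : (F G : Raw) (v i : ℕ) (q : Pos) → Compound F →
             substF F G v (i ∷ q) ≡ substF (sub F i) G v q
substF-sub F G v i q (inj₁ e) rewrite e = refl
substF-sub F G v i q (inj₂ e) rewrite e = refl

substF-root-defined : (F G : Raw) (v : ℕ) → IsJust (F []) → IsJust (G []) →
                      IsJust (substF F G v [])
substF-root-defined F G v (l , e) (lG , eG) with F [] in eq
... | just disj = _ , eq
... | just conj = _ , eq
... | just (pos w) with w ≡ᵇ v
...   | true  = lG , eG
...   | false = _ , eq
substF-root-defined F G v (l , e) (lG , eG) | just (neg w) with w ≡ᵇ v
...   | true  = negLab lG , cong (Maybe.map negLab) eG
...   | false = _ , eq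

solution-shape : {v : ℕ} {F G : Raw} → IsRecEq v F → IsSolution v F G →
                 (Disjunctive G × ∃ (λ i → InArity G i)) ⊎ Conjunctive G
solution-shape {v} {F} {G} (((_ , prefixF) , _) , compoundF , p , occurs) (((rootG , _) , _) , G≈) =
  shape compoundF
  where
  root : G [] ≡ F []
  root = trans (G≈ []) (substF-root F G v compoundF)

  -- the occurrence of 𝐯 or ¬𝐯 is not at the root, so F[G/𝐯] has a child
  has-child : ∀ p → (F p ≡ just (pos v)) ⊎ (F p ≡ just (neg v)) → ∃ λ i → InArity G i
  has-child []      o = ⊥-elim (compound-not-var {F} compoundF (v , o))
  has-child (i ∷ q) o =
    i , isJust-≡ (sym (trans (G≈ [ i ]) (substF-sub F G v i [] compoundF)))
          (substF-root-defined (sub F i) G v (prefixF [ i ] q (occurrence o)) rootG)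
    where
    occurrence : (F (i ∷ q) ≡ just (pos v)) ⊎ (F (i ∷ q) ≡ just (neg v)) → InDom F (i ∷ q)
    occurrence (inj₁ e) = _ , e
    occurrence (inj₂ e) = _ , e

  shape : Compound F → (Disjunctive G × ∃ (λ i → InArity G i)) ⊎ Conjunctive G
  shape (inj₁ disjF) = inj₁ (trans root disjF , has-child p occurs)
  shape (inj₂ conjF) = inj₂ (trans root conjF)

mainTheorem3 :
    (∀ (S : Raw) (n k : ℕ) → IsSequent S n → k < n →
      ((Disjunctive (sub S k) × ∃ (λ i → InArity (sub S k) i))
        ⊎ Conjunctive (sub S k)) →
      Derivable S)
    ×
    (∀ (v : ℕ) (F G : Raw) → IsRecEq v F → IsSolution v F G →
      Derivable (single G))
mainTheorem3 =
  principal-derivable ,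
  λ v F G recEq solution → single-derivable (proj₁ solution) (solution-shape recEq solution)
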